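{- Let $m$ be a positive integer, and let $\Gamma=S_{2m+1}$ if $m$ is odd and $\Gamma=A_{2m+1}$ if $m$ is even. For $m+1\le k\le 2m+1$ let $c_k$ be the permutation of $\{1,\dots,2m+1\}$ defined by \[c_k(i)=\begin{cases} i+m & \text{if } i<k-m,\\ i+m+1 & \text{if } k-m\le i\le m,\\ i-m & \text{if } m<i<k,\\ i & \text{if } i=k,\\ i-m-1 & \text{if } k<i\le 2m+1,\end{cases}\] (an involution), and let $C=\{c_k\mid m+1\le k\le 2m+1\}$ and $G=\mathrm{Cay}(\Gamma,C)$. Then the set $M=\{\pi\in\Gamma\mid \pi(1)\ge m+1\}$ has $\frac{m+1}{2m+1}|\Gamma|$ elements and induces a matching in $G$.
   Context: Products of permutations are composed left to right: $(\pi\cdot\tau)(i)=\tau(\pi(i))$. For a group $\Gamma$ and $C\subseteq\Gamma$, $\mathrm{Cay}(\Gamma,C)$ is the simple undirected graph on $\Gamma$ in which $\{x,y\}$ is an edge iff $x^{ -1}y\in C$, i.e. $y=x\cdot c$ for some $c\in C$. -}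

module Defs where

open import Data.Nat using (ℕ; zero; suc; _+_; _*_; _∸_; _<_; _≤_; _<?_; _≤?_; _≟_; _%_)
open import Data.Fin using (Fin; toℕ; fromℕ<) renaming (zero to fzero)
open import Data.Fin.Properties using (all?)
open import Data.Vec using (Vec; []; _∷_; lookup; tabulate)
open import Data.List using (List; [_]; concatMap; map; filter; length)
open import Data.List using () renaming ([] to [])
open import Data.Bool using (if_then_else_)
open import Data.Product using (_×_; Σ; ∃)
open import Relation.Nullary using (Dec; ¬_; yes; no)
open import Relation.Nullary.Decidable using (⌊_⌋; _×-dec_; _→-dec_)
open import Relation.Binary.PropositionalEquality using (_≡_; _≢_)
import Data.Fin as F

-- Permutations of {0,…,n-1} (the paper's {1,…,n}, shifted by one), represented as
-- the vector of images: π(i) = lookup π i.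
Vec' : ℕ → Set
Vec' n = Vec (Fin n) n

IsPerm : ∀ {n} → Vec' n → Set
IsPerm {n} π = ∀ (i j : Fin n) → lookup π i ≡ lookup π j → i ≡ j

isPerm? : ∀ {n} (π : Vec' n) → Dec (IsPerm π)
isPerm? π = all? (λ i → all? (λ j → (lookup π i F.≟ lookup π j) →-dec (i F.≟ j)))

-- Product composed left to right: (π · τ)(i) = τ(π(i)).
_·_ : ∀ {n} → Vec' n → Vec' n → Vec' n
π · τ = tabulate (λ i → lookup τ (lookup π i))

allFin' : (n : ℕ) → List (Fin n)
allFin' n = Data.List.tabulate (λ i → i)

inversions : ∀ {n} → Vec' n → ℕ
inversions {n} π =
  length (concatMap (λ i → filter (λ j → (i F.<? j) ×-dec (lookup π j F.<? lookup π i)) (allFin' n)) (allFin' n))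

IsEvenPerm : ∀ {n} → Vec' n → Set
IsEvenPerm π = inversions π % 2 ≡ 0

allVecs : (k n : ℕ) → List (Vec (Fin n) k)
allVecs zero n = [ [] ]
allVecs (suc k) n = concatMap (λ x → map (x ∷_) (allVecs k n)) (allFin' n)

card : ∀ {n} {P : Vec' n → Set} → ((π : Vec' n) → Dec (P π)) → ℕ
card {n} P? = length (filter P? (allVecs n n))

N : ℕ → ℕ
N m = suc (m + m)

InΓ : (m : ℕ) → Vec' (N m) → Set
InΓ m π = IsPerm π × (m % 2 ≡ 0 → IsEvenPerm π)

inΓ? : (m : ℕ) (π : Vec' (N m)) → Dec (InΓ m π)
inΓ? m π = isPerm? π ×-dec ((m % 2 ≟ 0) →-dec (inversions π % 2 ≟ 0))

-- M = {π ∈ Γ | π(1) ≥ m+1}; 0-indexed: π(0) ≥ m.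
InM : (m : ℕ) → Vec' (N m) → Set
InM m π = InΓ m π × (m ≤ toℕ (lookup π fzero))

inM? : (m : ℕ) (π : Vec' (N m)) → Dec (InM m π)
inM? m π = inΓ? m π ×-dec (m ≤? toℕ (lookup π fzero))

-- The paper's c_k on {1,…,2m+1} (1-indexed), verbatim.
cℕ : (m k i : ℕ) → ℕ
cℕ m k i =
  if ⌊ i <? k ∸ m ⌋ then i + m
  else if ⌊ i ≤? m ⌋ then i + m + 1
  else if ⌊ i <? k ⌋ then i ∸ m
  else if ⌊ i ≟ k ⌋ then i
  else i ∸ m ∸ 1

-- ℕ → Fin (suc n); only ever applied to values < suc n (the fallback is unreachable).
toFin : (n : ℕ) → ℕ → Fin (suc n)
toFin n x with x <? suc n
... | yes p = fromℕ< p
... | no _ = fzero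

-- c_k as an element of Vec' (2m+1), translated to 0-indexing:
-- c_k(p) = cℕ m k (p+1) - 1.
c : (m k : ℕ) → Vec' (N m)
c m k = tabulate (λ p → toFin (m + m) (cℕ m k (suc (toℕ p)) ∸ 1))

Adj : (m : ℕ) → Vec' (N m) → Vec' (N m) → Set
Adj m x y = x ≢ y × Σ ℕ (λ k → (m + 1 ≤ k) × (k ≤ 2 * m + 1) × (y ≡ x · c m k))

-- The sign of a permutation is multiplicative: the parity of the number of inversions of the
-- list of values of π · ρ differs from that of π by the number of pairs of values whose order ρ
-- reverses, and that number does not depend on the order in which the values are listed.
--
-- Composing values with the rotation x ↦ x − 1 (mod 2m+1), an even permutation, is a
-- bijection of Γ that moves the first entry one step around the cycle, so every first entry is
-- taken by the same number of elements of Γ; m + 1 of the 2m + 1 possible first entries lie in M.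
--
-- Matching. c_k is an involution whose only fixed point is k; read as a list of values it is a
-- concatenation of five increasing blocks, and counting the inversions between blocks shows that
-- its sign is (-1)^m, so c_k ∈ Γ. For π ∈ M with k = π(1), the partner π · c_k has first entry
-- c_k(k) = k and so lies in M; it differs from π because k is the only fixed point of c_k. If
-- π · c_k′ ∈ M as well, then k and c_k′(k) both exceed m, which forces k = k′.
module Submission where

open import Defs
open import Data.Nat using (ℕ; _+_; _*_; _≤_)
open import Data.Product using (_×_; Σ)
open import Relation.Binary.PropositionalEquality using (_≡_)

import Algebra.Properties.CommutativeSemigroup
open import Data.Bool using (Bool; true; false; not; _∧_; _xor_; if_then_else_)
open import Data.Bool.Properties using (xor-annihilates-not; ∧-identityʳ; ∧-zeroʳ)
open import Data.Empty using (⊥-elim)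
open import Data.Fin as Fin using (Fin; toℕ)
open import Data.Fin.Induction using (<-weakInduction)
import Data.Fin.Properties as Fin
open import Data.List using (List; []; _∷_; _++_; map; length; filter; concatMap; tabulate; allFin)
import Data.List.Properties as List
open import Data.List.Membership.Propositional using (_∈_)
open import Data.List.Membership.Propositional.Properties using (∈-tabulate⁺)
open import Data.List.Membership.Propositional.Properties.WithK using (unique∧set⇒bag)
open import Data.List.Relation.Binary.BagAndSetEquality using (∼bag⇒↭)
open import Data.List.Relation.Binary.Permutation.Propositional as ↭ using (_↭_)
import Data.List.Relation.Unary.Unique.Propositional.Properties as Unique
open import Data.Nat using (zero; suc; _∸_; _<_; _<?_; _≤?_; _≟_; _<ᵇ_; _≤ᵇ_; _%_; s≤s; z<s; s<s; parity)
open import Data.Nat.Properties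
open import Data.Nat.Tactic.RingSolver using (solve-∀)
import Data.Parity.Base as ℙ
open import Data.Parity.Base using (0ℙ)
import Data.Parity.Properties as ℙ
open import Data.Product using (∃; _,_; proj₁; proj₂)
open import Data.Vec as Vec using (Vec; lookup; _∷_)
import Data.Vec.Properties as Vec
open import Function using (_∘_; id)
open import Function.Bundles using (_⇔_; mk⇔; Equivalence)
open import Relation.Binary.Definitions using (tri<; tri≈; tri>)
open import Relation.Binary.PropositionalEquality
  using (_≢_; ≢-sym; refl; sym; trans; cong; cong₂; subst; _≗_; module ≡-Reasoning)
open import Relation.Nullary using (Dec; does; yes; no)
open import Relation.Nullary.Decidable using (_×-dec_; dec-true; dec-false; does-⇔)
open import Relation.Nullary.Negation using (contradiction)
open import Algebra.Properties.Group ℙ.+-0-group using (y≈x\\z)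
open import Algebra.Properties.Semiring.Sum +-*-semiring using (sum; sum-cong-≗; sum-init-last; *-distribʳ-sum)

open ≡-Reasoning

module ℕ+ = Algebra.Properties.CommutativeSemigroup +-commutativeSemigroup
module ℙ+ = Algebra.Properties.CommutativeSemigroup ℙ.+-commutativeSemigroup

private
  variable
    A B : Set
    n : ℕ

-- Counting with Boolean predicates

bit : Bool → ℕ
bit b = if b then 1 else 0

count : (A → Bool) → List A → ℕ
count p []       = 0
count p (x ∷ xs) = bit (p x) + count p xs

count-++ : (p : A → Bool) (xs ys : List A) → count p (xs ++ ys) ≡ count p xs + count p ys
count-++ p []       ys = refl
count-++ p (x ∷ xs) ys = trans (cong (bit (p x) +_) (count-++ p xs ys)) (sym (+-assoc (bit (p x)) _ _))

count-map : (p : B → Bool) (f : A → B) (xs : List A) → count p (map f xs) ≡ count (p ∘ f) xs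
count-map p f []       = refl
count-map p f (x ∷ xs) = cong (bit (p (f x)) +_) (count-map p f xs)

count-cong : {p q : A → Bool} → p ≗ q → (xs : List A) → count p xs ≡ count q xs
count-cong p≗q []       = refl
count-cong p≗q (x ∷ xs) = cong₂ (λ b c → bit b + c) (p≗q x) (count-cong p≗q xs)

count-∧-const : (p : A → Bool) (b : Bool) (xs : List A) → count (λ x → p x ∧ b) xs ≡ bit b * count p xs
count-∧-const p true  xs       = trans (count-cong (λ x → ∧-identityʳ (p x)) xs) (sym (*-identityˡ _))
count-∧-const p false []       = refl
count-∧-const p false (x ∷ xs) =
  trans (cong (λ b → bit b + count (λ x → p x ∧ false) xs) (∧-zeroʳ (p x))) (count-∧-const p false xs)

count-↭ : (p : A → Bool) {xs ys : List A} → xs ↭ ys → count p xs ≡ count p ys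
count-↭ p ↭.refl                 = refl
count-↭ p (↭.prep x xs↭ys)        = cong (bit (p x) +_) (count-↭ p xs↭ys)
count-↭ p (↭.swap {xs} x y xs↭ys) = trans (ℕ+.x∙yz≈y∙xz (bit (p x)) (bit (p y)) (count p xs))
                                          (cong (λ c → bit (p y) + (bit (p x) + c)) (count-↭ p xs↭ys))
count-↭ p (↭.trans xs↭ys ys↭zs)   = trans (count-↭ p xs↭ys) (count-↭ p ys↭zs)

count-tabulate : (p : A → Bool) (f : Fin n → A) → count p (tabulate f) ≡ sum (bit ∘ p ∘ f)
count-tabulate {n = zero}  p f = refl
count-tabulate {n = suc n} p f = cong (bit (p (f Fin.zero)) +_) (count-tabulate p (f ∘ Fin.suc))

count-concatMap-tabulate : (p : B → Bool) (g : A → List B) (f : Fin n → A) →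
                           count p (concatMap g (tabulate f)) ≡ sum (λ i → count p (g (f i)))
count-concatMap-tabulate {n = zero}  p g f = refl
count-concatMap-tabulate {n = suc n} p g f = trans (count-++ p (g (f Fin.zero)) _)
  (cong (count p (g (f Fin.zero)) +_) (count-concatMap-tabulate p g (f ∘ Fin.suc)))

length-concatMap-tabulate : (g : A → List B) (f : Fin n → A) →
                            length (concatMap g (tabulate f)) ≡ sum (length ∘ g ∘ f)
length-concatMap-tabulate {n = zero}  g f = refl
length-concatMap-tabulate {n = suc n} g f = trans (List.length-++ (g (f Fin.zero)))
  (cong (length (g (f Fin.zero)) +_) (length-concatMap-tabulate g (f ∘ Fin.suc)))

length-filter-count : {P : A → Set} (P? : ∀ x → Dec (P x)) (xs : List A) →
                      length (filter P? xs) ≡ count (does ∘ P?) xs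
length-filter-count P? []       = refl
length-filter-count P? (x ∷ xs) with does (P? x)
... | true  = cong suc (length-filter-count P? xs)
... | false = length-filter-count P? xs

parity-count-xor : (p q : A → Bool) (xs : List A) →
                   parity (count p xs) ℙ.+ parity (count q xs) ≡ parity (count (λ x → p x xor q x) xs)
parity-count-xor p q []       = refl
parity-count-xor p q (x ∷ xs) = begin
  parity (bit (p x) + count p xs) ℙ.+ parity (bit (q x) + count q xs)
    ≡⟨ cong₂ ℙ._+_ (ℙ.+-homo-+ (bit (p x)) _) (ℙ.+-homo-+ (bit (q x)) _) ⟩
  (parity (bit (p x)) ℙ.+ parity (count p xs)) ℙ.+ (parity (bit (q x)) ℙ.+ parity (count q xs))
    ≡⟨ ℙ+.interchange (parity (bit (p x))) (parity (count p xs)) (parity (bit (q x))) (parity (count q xs)) ⟩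
  (parity (bit (p x)) ℙ.+ parity (bit (q x))) ℙ.+ (parity (count p xs) ℙ.+ parity (count q xs))
    ≡⟨ cong₂ ℙ._+_ (parity-bit-xor (p x) (q x)) (parity-count-xor p q xs) ⟩
  parity (bit (p x xor q x)) ℙ.+ parity (count (λ x → p x xor q x) xs)
    ≡⟨ ℙ.+-homo-+ (bit (p x xor q x)) _ ⟨
  parity (count (λ x → p x xor q x) (x ∷ xs)) ∎
  where
  parity-bit-xor : ∀ a b → parity (bit a) ℙ.+ parity (bit b) ≡ parity (bit (a xor b))
  parity-bit-xor true  true  = refl
  parity-bit-xor true  false = refl
  parity-bit-xor false b     = refl

<ᵇ-flip : ∀ m n → m ≢ n → (m <ᵇ n) ≡ not (n <ᵇ m)
<ᵇ-flip zero    zero    m≢n = ⊥-elim (m≢n refl)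
<ᵇ-flip zero    (suc n) _   = refl
<ᵇ-flip (suc m) zero    _   = refl
<ᵇ-flip (suc m) (suc n) m≢n = <ᵇ-flip m n (m≢n ∘ cong suc)

-- Inversions of lists

module Inversions (key : A → ℕ) where

  inv : List A → ℕ
  inv []       = 0
  inv (x ∷ xs) = count (λ y → key y <ᵇ key x) xs + inv xs

  flipped : (A → A) → A → A → Bool
  flipped f x y = (key y <ᵇ key x) xor (key (f y) <ᵇ key (f x))

  flips : (A → A) → List A → ℕ
  flips f []       = 0
  flips f (x ∷ xs) = count (flipped f x) xs + flips f xs

  parity-inv-map : (f : A → A) (xs : List A) →
                   parity (inv xs) ℙ.+ parity (inv (map f xs)) ≡ parity (flips f xs)
  parity-inv-map f []       = refl
  parity-inv-map f (x ∷ xs) = begin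
    parity (cx + inv xs) ℙ.+ parity (count (λ y → key y <ᵇ key (f x)) (map f xs) + inv (map f xs))
      ≡⟨ cong (λ d → parity (cx + inv xs) ℙ.+ parity (d + inv (map f xs))) (count-map _ f xs) ⟩
    parity (cx + inv xs) ℙ.+ parity (cf + inv (map f xs))
      ≡⟨ cong₂ ℙ._+_ (ℙ.+-homo-+ cx _) (ℙ.+-homo-+ cf _) ⟩
    (parity cx ℙ.+ parity (inv xs)) ℙ.+ (parity cf ℙ.+ parity (inv (map f xs)))
      ≡⟨ ℙ+.interchange (parity cx) (parity (inv xs)) (parity cf) (parity (inv (map f xs))) ⟩
    (parity cx ℙ.+ parity cf) ℙ.+ (parity (inv xs) ℙ.+ parity (inv (map f xs)))
      ≡⟨ cong₂ ℙ._+_ (parity-count-xor _ _ xs) (parity-inv-map f xs) ⟩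
    parity (count (flipped f x) xs) ℙ.+ parity (flips f xs)
      ≡⟨ ℙ.+-homo-+ (count (flipped f x) xs) _ ⟨
    parity (flips f (x ∷ xs)) ∎
    where
    cx cf : ℕ
    cx = count (λ y → key y <ᵇ key x) xs
    cf = count (λ y → key (f y) <ᵇ key (f x)) xs

  flipped-sym : (∀ {x y} → key x ≡ key y → x ≡ y) → (f : A → A) → (∀ {x y} → f x ≡ f y → x ≡ y) →
                ∀ x y → flipped f x y ≡ flipped f y x
  flipped-sym key-inj f f-inj x y with key x ≟ key y
  ... | yes kx≡ky rewrite key-inj kx≡ky = refl
  ... | no  kx≢ky = begin
    (key y <ᵇ key x) xor (key (f y) <ᵇ key (f x))
      ≡⟨ cong₂ _xor_ (<ᵇ-flip _ _ (kx≢ky ∘ sym))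
                     (<ᵇ-flip _ _ (kx≢ky ∘ sym ∘ cong key ∘ f-inj ∘ key-inj)) ⟩
    not (key x <ᵇ key y) xor not (key (f x) <ᵇ key (f y))
      ≡⟨ xor-annihilates-not (key x <ᵇ key y) (key (f x) <ᵇ key (f y)) ⟩
    (key x <ᵇ key y) xor (key (f x) <ᵇ key (f y)) ∎

  flips-↭ : (f : A → A) → (∀ x y → flipped f x y ≡ flipped f y x) →
            {xs ys : List A} → xs ↭ ys → flips f xs ≡ flips f ys
  flips-↭ f sym-f ↭.refl                       = refl
  flips-↭ f sym-f (↭.prep x xs↭ys)              =
    cong₂ _+_ (count-↭ (flipped f x) xs↭ys) (flips-↭ f sym-f xs↭ys)
  flips-↭ f sym-f (↭.swap {xs} {ys} x y xs↭ys) = begin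
    (bit (flipped f x y) + count (flipped f x) xs) + (count (flipped f y) xs + flips f xs)
      ≡⟨ ℕ+.interchange (bit (flipped f x y)) (count (flipped f x) xs) (count (flipped f y) xs) (flips f xs) ⟩
    (bit (flipped f x y) + count (flipped f y) xs) + (count (flipped f x) xs + flips f xs)
      ≡⟨ cong₂ _+_ (cong₂ _+_ (cong bit (sym-f x y)) (count-↭ (flipped f y) xs↭ys))
                   (cong₂ _+_ (count-↭ (flipped f x) xs↭ys) (flips-↭ f sym-f xs↭ys)) ⟩
    (bit (flipped f y x) + count (flipped f y) ys) + (count (flipped f x) ys + flips f ys) ∎
  flips-↭ f sym-f (↭.trans xs↭ys ys↭zs)         = trans (flips-↭ f sym-f xs↭ys) (flips-↭ f sym-f ys↭zs)

  parity-inv-map-↭ : (∀ {x y} → key x ≡ key y → x ≡ y) → (f : A → A) → (∀ {x y} → f x ≡ f y → x ≡ y) →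
                     {xs ys : List A} → xs ↭ ys →
                     parity (inv xs) ℙ.+ parity (inv (map f xs)) ≡ parity (inv ys) ℙ.+ parity (inv (map f ys))
  parity-inv-map-↭ key-inj f f-inj {xs} {ys} xs↭ys = begin
    parity (inv xs) ℙ.+ parity (inv (map f xs)) ≡⟨ parity-inv-map f xs ⟩
    parity (flips f xs)
      ≡⟨ cong parity (flips-↭ f (flipped-sym key-inj f f-inj) xs↭ys) ⟩
    parity (flips f ys)                         ≡⟨ parity-inv-map f ys ⟨
    parity (inv ys) ℙ.+ parity (inv (map f ys)) ∎

open Inversions using (inv)

inv-map : (key : B → ℕ) (g : A → B) (xs : List A) → inv key (map g xs) ≡ inv (key ∘ g) xs
inv-map key g []       = refl
inv-map key g (x ∷ xs) = cong₂ _+_ (count-map _ g xs) (inv-map key g xs)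

range : ℕ → ℕ → List ℕ
range s zero    = []
range s (suc l) = s ∷ range (suc s) l

range-++ : ∀ s l l′ → range s (l + l′) ≡ range s l ++ range (s + l) l′
range-++ s zero    l′ = cong (λ t → range t l′) (sym (+-identityʳ s))
range-++ s (suc l) l′ = cong (s ∷_) (trans (range-++ (suc s) l l′)
                                           (cong (λ t → range (suc s) l ++ range t l′) (sym (+-suc s l))))

tabulate-+toℕ : ∀ s → tabulate {n = n} (λ i → s + toℕ i) ≡ range s n
tabulate-+toℕ {n = zero}  s = refl
tabulate-+toℕ {n = suc n} s =
  cong₂ _∷_ (+-identityʳ s) (trans (List.tabulate-cong (λ i → +-suc s (toℕ i))) (tabulate-+toℕ (suc s)))

map-range : (f : ℕ → ℕ) (s t l : ℕ) → (∀ j → j < l → f (s + j) ≡ t + j) → map f (range s l) ≡ range t l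
map-range f s t zero    _  = refl
map-range f s t (suc l) f≡ = cong₂ _∷_
  (trans (cong f (sym (+-identityʳ s))) (trans (f≡ 0 z<s) (+-identityʳ t)))
  (map-range f (suc s) (suc t) l λ j j<l →
    trans (cong f (sym (+-suc s j))) (trans (f≡ (suc j) (s<s j<l)) (+-suc t j)))

count-range-< : ∀ x s l → s + l ≤ x → count (_<ᵇ x) (range s l) ≡ l
count-range-< x s zero    _       = refl
count-range-< x s (suc l) s+l<x
  rewrite dec-true (s <? x) (<-≤-trans (m<m+n s z<s) s+l<x)
  = cong suc (count-range-< x (suc s) l (subst (_≤ x) (+-suc s l) s+l<x))

count-range-≥ : ∀ x s l → x ≤ s → count (_<ᵇ x) (range s l) ≡ 0
count-range-≥ x s zero    x≤s = refl
count-range-≥ x s (suc l) x≤s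
  rewrite dec-false (s <? x) (≤⇒≯ x≤s) = count-range-≥ x (suc s) l (m≤n⇒m≤1+n x≤s)

count-≤ᵇ-range-< : ∀ x s l → s + l ≤ x → count (x ≤ᵇ_) (range s l) ≡ 0
count-≤ᵇ-range-< x s zero    _ = refl
count-≤ᵇ-range-< x s (suc l) s+l≤x
  rewrite dec-false (x ≤? s) (<⇒≱ (<-≤-trans (m<m+n s z<s) s+l≤x))
  = count-≤ᵇ-range-< x (suc s) l (subst (_≤ x) (+-suc s l) s+l≤x)

count-≤ᵇ-range-≥ : ∀ x s l → x ≤ s → count (x ≤ᵇ_) (range s l) ≡ l
count-≤ᵇ-range-≥ x s zero    _   = refl
count-≤ᵇ-range-≥ x s (suc l) x≤s
  rewrite dec-true (x ≤? s) x≤s = cong suc (count-≤ᵇ-range-≥ x (suc s) l (m≤n⇒m≤1+n x≤s))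

inv-range : ∀ s l → inv id (range s l) ≡ 0
inv-range s zero    = refl
inv-range s (suc l) = cong₂ _+_ (count-range-≥ s (suc s) l (n≤1+n s)) (inv-range (suc s) l)

cross : List ℕ → List ℕ → ℕ
cross []       ys = 0
cross (x ∷ xs) ys = count (_<ᵇ x) ys + cross xs ys

inv-++ : ∀ xs ys → inv id (xs ++ ys) ≡ inv id xs + (cross xs ys + inv id ys)
inv-++ []       ys = refl
inv-++ (x ∷ xs) ys = begin
  count (_<ᵇ x) (xs ++ ys) + inv id (xs ++ ys)
    ≡⟨ cong₂ _+_ (count-++ (_<ᵇ x) xs ys) (inv-++ xs ys) ⟩
  (count (_<ᵇ x) xs + count (_<ᵇ x) ys) + (inv id xs + (cross xs ys + inv id ys))
    ≡⟨ rearrange (count (_<ᵇ x) xs) (count (_<ᵇ x) ys) (inv id xs) (cross xs ys) (inv id ys) ⟩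
  (count (_<ᵇ x) xs + inv id xs) + ((count (_<ᵇ x) ys + cross xs ys) + inv id ys) ∎
  where
  rearrange : ∀ a b c d e → (a + b) + (c + (d + e)) ≡ (a + c) + ((b + d) + e)
  rearrange = solve-∀

cross-++ : ∀ xs ys zs → cross xs (ys ++ zs) ≡ cross xs ys + cross xs zs
cross-++ []       ys zs = refl
cross-++ (x ∷ xs) ys zs = begin
  count (_<ᵇ x) (ys ++ zs) + cross xs (ys ++ zs)
    ≡⟨ cong₂ _+_ (count-++ (_<ᵇ x) ys zs) (cross-++ xs ys zs) ⟩
  (count (_<ᵇ x) ys + count (_<ᵇ x) zs) + (cross xs ys + cross xs zs)
    ≡⟨ ℕ+.interchange (count (_<ᵇ x) ys) (count (_<ᵇ x) zs) (cross xs ys) (cross xs zs) ⟩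
  (count (_<ᵇ x) ys + cross xs ys) + (count (_<ᵇ x) zs + cross xs zs) ∎

cross-range-above : ∀ s l t l′ → t + l′ ≤ s → cross (range s l) (range t l′) ≡ l * l′
cross-range-above s zero    t l′ _      = refl
cross-range-above s (suc l) t l′ t+l′≤s =
  cong₂ _+_ (count-range-< s t l′ t+l′≤s) (cross-range-above (suc s) l t l′ (m≤n⇒m≤1+n t+l′≤s))

cross-range-below : ∀ s l t l′ → s + l ≤ t → cross (range s l) (range t l′) ≡ 0
cross-range-below s zero    t l′ _     = refl
cross-range-below s (suc l) t l′ s+l≤t =
  cong₂ _+_ (count-range-≥ s t l′ (≤-trans (m≤m+n s (suc l)) s+l≤t))
            (cross-range-below (suc s) l t l′ (subst (_≤ t) (+-suc s l) s+l≤t))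

-- The sign of a permutation

∑-inversions : (key : A → ℕ) (v : Fin n → A) →
               sum (λ i → sum (λ j → bit ((toℕ i <ᵇ toℕ j) ∧ (key (v j) <ᵇ key (v i)))))
               ≡ inv key (tabulate v)
∑-inversions {n = zero}  key v = refl
∑-inversions {n = suc n} key v =
  cong₂ _+_ (sym (count-tabulate (λ y → key y <ᵇ key (v Fin.zero)) (v ∘ Fin.suc)))
            (∑-inversions key (v ∘ Fin.suc))

inversions≡inv : (π : Vec' n) → inversions π ≡ inv toℕ (tabulate (lookup π))
inversions≡inv {n} π = begin
  inversions π
    ≡⟨ length-concatMap-tabulate (λ i → filter (Q i) (allFin n)) id ⟩
  sum (λ i → length (filter (Q i) (allFin n)))
    ≡⟨ sum-cong-≗ (λ i → trans (length-filter-count (Q i) (allFin n)) (count-tabulate (does ∘ Q i) id)) ⟩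
  sum (λ i → sum (λ j → bit (does (Q i j))))
    ≡⟨ ∑-inversions toℕ (lookup π) ⟩
  inv toℕ (tabulate (lookup π)) ∎
  where
  Q : (i j : Fin n) → Dec (i Fin.< j × lookup π j Fin.< lookup π i)
  Q i j = (i Fin.<? j) ×-dec (lookup π j Fin.<? lookup π i)

inversions≡inv-map-range : (π : Vec' n) (f : ℕ → ℕ) → (∀ x → toℕ (lookup π x) ≡ f (toℕ x)) →
                           inversions π ≡ inv id (map f (range 0 n))
inversions≡inv-map-range {n} π f π≗f = begin
  inversions π                           ≡⟨ inversions≡inv π ⟩
  inv toℕ (tabulate (lookup π))          ≡⟨ inv-map id toℕ (tabulate (lookup π)) ⟨
  inv id (map toℕ (tabulate (lookup π))) ≡⟨ cong (inv id) (List.map-tabulate (lookup π) toℕ) ⟩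
  inv id (tabulate (toℕ ∘ lookup π))     ≡⟨ cong (inv id) (List.tabulate-cong π≗f) ⟩
  inv id (tabulate (f ∘ toℕ {n}))        ≡⟨ cong (inv id) (List.map-tabulate (toℕ {n}) f) ⟨
  inv id (map f (tabulate (toℕ {n})))    ≡⟨ cong (inv id ∘ map f) (tabulate-+toℕ {n = n} 0) ⟩
  inv id (map f (range 0 n))             ∎

inv-allFin : ∀ n → inv toℕ (allFin n) ≡ 0
inv-allFin n = begin
  inv toℕ (allFin n)            ≡⟨ inv-map id toℕ (allFin n) ⟨
  inv id (map toℕ (allFin n))   ≡⟨ cong (inv id) (List.map-tabulate {n = n} id toℕ) ⟩
  inv id (tabulate {n = n} toℕ) ≡⟨ cong (inv id) (tabulate-+toℕ {n = n} 0) ⟩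
  inv id (range 0 n)            ≡⟨ inv-range 0 n ⟩
  0                             ∎

injective⇒surjective : (f : Fin n → Fin n) → (∀ {i j} → f i ≡ f j → i ≡ j) → ∀ y → ∃ λ x → f x ≡ y
injective⇒surjective {suc n} f f-inj y with Fin.any? (λ x → f x Fin.≟ y)
... | yes hit  = hit
... | no  miss = ⊥-elim (1+n≰n (Fin.injective⇒≤ (f-inj ∘ Fin.punchOut-injective y≢f y≢f)))
  where
  y≢f : ∀ {x} → y ≢ f x
  y≢f {x} y≡fx = miss (x , sym y≡fx)

IsPerm⇒↭allFin : (π : Vec' n) → IsPerm π → tabulate (lookup π) ↭ allFin n
IsPerm⇒↭allFin π π-inj = ∼bag⇒↭ (unique∧set⇒bag
  (Unique.tabulate⁺ (λ {i} {j} → π-inj i j)) (Unique.tabulate⁺ id)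
  (λ {x} → mk⇔ (λ _ → ∈-tabulate⁺ x)
               (λ _ → let (i , πi≡x) = injective⇒surjective (lookup π) (π-inj _ _) x
                      in subst (_∈ tabulate (lookup π)) πi≡x (∈-tabulate⁺ i))))

lookup-· : (π ρ : Vec' n) (i : Fin n) → lookup (π · ρ) i ≡ lookup ρ (lookup π i)
lookup-· π ρ = Vec.lookup∘tabulate (lookup ρ ∘ lookup π)

·-tabulate : (v : Vec' n) (f : Fin n → Fin n) → v · Vec.tabulate f ≡ Vec.map f v
·-tabulate v f = begin
  Vec.tabulate (λ i → lookup (Vec.tabulate f) (lookup v i))
    ≡⟨ Vec.tabulate-cong (λ i → Vec.lookup∘tabulate f (lookup v i)) ⟩
  Vec.tabulate (f ∘ lookup v)         ≡⟨ Vec.tabulate-∘ f (lookup v) ⟩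
  Vec.map f (Vec.tabulate (lookup v)) ≡⟨ cong (Vec.map f) (Vec.tabulate∘lookup v) ⟩
  Vec.map f v                         ∎

IsPerm-· : (π ρ : Vec' n) → IsPerm π → IsPerm ρ → IsPerm (π · ρ)
IsPerm-· π ρ π-inj ρ-inj i j e =
  π-inj i j (ρ-inj _ _ (trans (sym (lookup-· π ρ i)) (trans e (lookup-· π ρ j))))

IsPerm-·⁻¹ : (π ρ : Vec' n) → IsPerm (π · ρ) → IsPerm π
IsPerm-·⁻¹ π ρ πρ-inj i j e =
  πρ-inj i j (trans (lookup-· π ρ i) (trans (cong (lookup ρ) e) (sym (lookup-· π ρ j))))

parity-inversions-· : (π ρ : Vec' n) → IsPerm π → IsPerm ρ →
                      parity (inversions (π · ρ)) ≡ parity (inversions π) ℙ.+ parity (inversions ρ)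
parity-inversions-· {n} π ρ π-inj ρ-inj = begin
  parity (inversions (π · ρ))
    ≡⟨ cong parity (trans (inversions≡inv (π · ρ)) (cong (inv toℕ) tabulate-πρ)) ⟩
  parity (inv toℕ (map (lookup ρ) xs))
    -- in the group of parities every element is its own inverse, so x \\ z is x + z
    ≡⟨ y≈x\\z (parity (inv toℕ xs)) _ _ (begin
      parity (inv toℕ xs) ℙ.+ parity (inv toℕ (map (lookup ρ) xs))
        ≡⟨ Inversions.parity-inv-map-↭ toℕ Fin.toℕ-injective (lookup ρ) (ρ-inj _ _)
                                        (IsPerm⇒↭allFin π π-inj) ⟩
      parity (inv toℕ (allFin n)) ℙ.+ parity (inv toℕ (map (lookup ρ) (allFin n)))
        ≡⟨ cong₂ (λ a b → parity a ℙ.+ parity (inv toℕ b))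
                 (inv-allFin n) (List.map-tabulate id (lookup ρ)) ⟩
      parity (inv toℕ (tabulate (lookup ρ)))
        ≡⟨ cong parity (inversions≡inv ρ) ⟨
      parity (inversions ρ) ∎) ⟩
  parity (inv toℕ xs) ℙ.+ parity (inversions ρ)
    ≡⟨ cong (λ k → parity k ℙ.+ parity (inversions ρ)) (inversions≡inv π) ⟨
  parity (inversions π) ℙ.+ parity (inversions ρ) ∎
  where
  xs : List (Fin n)
  xs = tabulate (lookup π)
  tabulate-πρ : tabulate (lookup (π · ρ)) ≡ map (lookup ρ) xs
  tabulate-πρ = trans (List.tabulate-cong (lookup-· π ρ)) (sym (List.map-tabulate (lookup π) (lookup ρ)))

%2≡0⇔parity≡0ℙ : ∀ k → k % 2 ≡ 0 ⇔ parity k ≡ 0ℙ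
%2≡0⇔parity≡0ℙ k = mk⇔ (to k) (from k)
  where
  to : ∀ k → k % 2 ≡ 0 → parity k ≡ 0ℙ
  to zero          _ = refl
  to (suc (suc k)) e = to k e
  from : ∀ k → parity k ≡ 0ℙ → k % 2 ≡ 0
  from zero          _ = refl
  from (suc (suc k)) e = from k e

InΓ-·ʳ : ∀ m (π ρ : Vec' (N m)) → InΓ m ρ → InΓ m (π · ρ) ⇔ InΓ m π
InΓ-·ʳ m π ρ (ρ-inj , ρ-even) = mk⇔
  (λ (πρ-inj , πρ-even) → let π-inj = IsPerm-·⁻¹ π ρ πρ-inj in
     π-inj , λ m-even → from (%2≡0⇔parity≡0ℙ (inversions π))
       (trans (sym (same-parity π-inj m-even))
              (to (%2≡0⇔parity≡0ℙ (inversions (π · ρ))) (πρ-even m-even))))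
  (λ (π-inj , π-even) → IsPerm-· π ρ π-inj ρ-inj ,
     λ m-even → from (%2≡0⇔parity≡0ℙ (inversions (π · ρ)))
       (trans (same-parity π-inj m-even) (to (%2≡0⇔parity≡0ℙ (inversions π)) (π-even m-even))))
  where
  open Equivalence
  same-parity : IsPerm π → m % 2 ≡ 0 → parity (inversions (π · ρ)) ≡ parity (inversions π)
  same-parity π-inj m-even = begin
    parity (inversions (π · ρ))                     ≡⟨ parity-inversions-· π ρ π-inj ρ-inj ⟩
    parity (inversions π) ℙ.+ parity (inversions ρ) ≡⟨ cong (parity (inversions π) ℙ.+_)
                                                            (to (%2≡0⇔parity≡0ℙ (inversions ρ)) (ρ-even m-even)) ⟩
    parity (inversions π) ℙ.+ 0ℙ                    ≡⟨ ℙ.+-identityʳ _ ⟩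
    parity (inversions π)                           ∎

-- Counting Γ by first entries

rotate : Fin (suc n) → Fin (suc n)
rotate Fin.zero    = Fin.fromℕ _
rotate (Fin.suc i) = Fin.inject₁ i

rotate-injective : {i j : Fin (suc n)} → rotate i ≡ rotate j → i ≡ j
rotate-injective {i = Fin.zero}  {Fin.zero}  _ = refl
rotate-injective {i = Fin.zero}  {Fin.suc j} e = ⊥-elim (Fin.fromℕ≢inject₁ e)
rotate-injective {i = Fin.suc i} {Fin.zero}  e = ⊥-elim (Fin.fromℕ≢inject₁ (sym e))
rotate-injective {i = Fin.suc i} {Fin.suc j} e = cong Fin.suc (Fin.inject₁-injective e)

rotation : ∀ n → Vec' (suc n)
rotation n = Vec.tabulate rotate

inversions-rotation : ∀ n → inversions (rotation n) ≡ n
inversions-rotation n = begin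
  inversions (rotation n)
    ≡⟨ inversions≡inv-map-range (rotation n) shadow toℕ-rotation ⟩
  inv id (n ∷ map shadow (range 1 n))
    ≡⟨ cong (inv id ∘ (n ∷_)) (map-range shadow 1 0 n (λ _ _ → refl)) ⟩
  count (_<ᵇ n) (range 0 n) + inv id (range 0 n)
    ≡⟨ cong₂ _+_ (count-range-< n 0 n ≤-refl) (inv-range 0 n) ⟩
  n + 0
    ≡⟨ +-identityʳ n ⟩
  n ∎
  where
  shadow : ℕ → ℕ
  shadow zero    = n
  shadow (suc x) = x
  toℕ-rotation : ∀ x → toℕ (lookup (rotation n) x) ≡ shadow (toℕ x)
  toℕ-rotation x = trans (cong toℕ (Vec.lookup∘tabulate rotate x)) (toℕ-rotate x)
    where
    toℕ-rotate : ∀ x → toℕ (rotate x) ≡ shadow (toℕ x)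
    toℕ-rotate Fin.zero    = Fin.toℕ-fromℕ n
    toℕ-rotate (Fin.suc i) = Fin.toℕ-inject₁ i

rotation∈Γ : ∀ m → InΓ m (rotation (m + m))
rotation∈Γ m = rotation-injective , λ _ → from (%2≡0⇔parity≡0ℙ (inversions (rotation (m + m)))) (begin
  parity (inversions (rotation (m + m))) ≡⟨ cong parity (inversions-rotation (m + m)) ⟩
  parity (m + m)                         ≡⟨ ℙ.+-homo-+ m m ⟩
  parity m ℙ.+ parity m                  ≡⟨ ℙ.p+p≡0ℙ (parity m) ⟩
  0ℙ                                     ∎)
  where
  open Equivalence
  rotation-injective : IsPerm (rotation (m + m))
  rotation-injective i j e = rotate-injective
    (trans (sym (Vec.lookup∘tabulate rotate i)) (trans e (Vec.lookup∘tabulate rotate j)))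

∑-rotate : (h : Fin (suc n) → ℕ) → sum (h ∘ rotate) ≡ sum h
∑-rotate h = trans (+-comm (h (Fin.fromℕ _)) _) (sym (sum-init-last h))

∑-const : ∀ n c → sum {n} (λ _ → c) ≡ n * c
∑-const zero    c = refl
∑-const (suc n) c = cong (c +_) (∑-const n c)

count-allVecs : ∀ k n (p : Vec (Fin n) (suc k) → Bool) →
                count p (allVecs (suc k) n) ≡ sum (λ x → count (λ t → p (x ∷ t)) (allVecs k n))
count-allVecs k n p = trans (count-concatMap-tabulate p (λ x → map (x ∷_) (allVecs k n)) id)
                            (sum-cong-≗ (λ x → count-map p (x ∷_) (allVecs k n)))

count-allVecs-rotate : ∀ k (p : Vec (Fin (suc n)) k → Bool) →
                       count (p ∘ Vec.map rotate) (allVecs k (suc n)) ≡ count p (allVecs k (suc n))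
count-allVecs-rotate         zero    p = refl
count-allVecs-rotate {n = n} (suc k) p = begin
  count (p ∘ Vec.map rotate) (allVecs (suc k) (suc n))
    ≡⟨ count-allVecs k (suc n) (p ∘ Vec.map rotate) ⟩
  sum (λ x → count (λ t → p (rotate x ∷ Vec.map rotate t)) (allVecs k (suc n)))
    ≡⟨ sum-cong-≗ (λ x → count-allVecs-rotate k (λ t → p (rotate x ∷ t))) ⟩
  sum (λ x → count (λ t → p (rotate x ∷ t)) (allVecs k (suc n)))
    ≡⟨ ∑-rotate (λ y → count (λ t → p (y ∷ t)) (allVecs k (suc n))) ⟩
  sum (λ x → count (λ t → p (x ∷ t)) (allVecs k (suc n)))
    ≡⟨ count-allVecs k (suc n) p ⟨
  count p (allVecs (suc k) (suc n)) ∎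

count-≤ᵇ-range-N : ∀ m → count (m ≤ᵇ_) (range 0 (N m)) ≡ suc m
count-≤ᵇ-range-N m = begin
  count (m ≤ᵇ_) (range 0 (suc (m + m)))
    ≡⟨ cong (count (m ≤ᵇ_) ∘ range 0) (+-suc m m) ⟨
  count (m ≤ᵇ_) (range 0 (m + suc m))
    ≡⟨ cong (count (m ≤ᵇ_)) (range-++ 0 m (suc m)) ⟩
  count (m ≤ᵇ_) (range 0 m ++ range m (suc m))
    ≡⟨ count-++ (m ≤ᵇ_) (range 0 m) _ ⟩
  count (m ≤ᵇ_) (range 0 m) + count (m ≤ᵇ_) (range m (suc m))
    ≡⟨ cong₂ _+_ (count-≤ᵇ-range-< m 0 m ≤-refl) (count-≤ᵇ-range-≥ m m (suc m) ≤-refl) ⟩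
  suc m ∎

module Counting (m : ℕ) where

  inΓ-rotate : (v : Vec' (N m)) → does (inΓ? m (Vec.map rotate v)) ≡ does (inΓ? m v)
  inΓ-rotate v = subst (λ w → does (inΓ? m w) ≡ does (inΓ? m v)) (·-tabulate v rotate)
    (does-⇔ (InΓ-·ʳ m v (rotation (m + m)) (rotation∈Γ m)) (inΓ? m (v · rotation (m + m))) (inΓ? m v))

  tails : List (Vec (Fin (N m)) (m + m))
  tails = allVecs (m + m) (N m)

  fibre : Fin (N m) → ℕ
  fibre x = count (λ t → does (inΓ? m (x ∷ t))) tails

  fibre-rotate : ∀ x → fibre (rotate x) ≡ fibre x
  fibre-rotate x = trans (sym (count-allVecs-rotate (m + m) (λ t → does (inΓ? m (rotate x ∷ t)))))
                         (count-cong (λ t → inΓ-rotate (x ∷ t)) tails)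

  fibre-constant : ∀ x → fibre x ≡ fibre Fin.zero
  fibre-constant = <-weakInduction (λ x → fibre x ≡ fibre Fin.zero) refl
                     (λ i fibre-i → trans (sym (fibre-rotate (Fin.suc i))) fibre-i)

  card-Γ : card (inΓ? m) ≡ N m * fibre Fin.zero
  card-Γ = begin
    card (inΓ? m)                               ≡⟨ length-filter-count (inΓ? m) (allVecs (N m) (N m)) ⟩
    count (does ∘ inΓ? m) (allVecs (N m) (N m)) ≡⟨ count-allVecs (m + m) (N m) _ ⟩
    sum fibre                                   ≡⟨ sum-cong-≗ fibre-constant ⟩
    sum {N m} (λ _ → fibre Fin.zero)            ≡⟨ ∑-const (N m) _ ⟩
    N m * fibre Fin.zero                        ∎

  card-M : card (inM? m) ≡ suc m * fibre Fin.zero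
  card-M = begin
    card (inM? m)                               ≡⟨ length-filter-count (inM? m) (allVecs (N m) (N m)) ⟩
    count (does ∘ inM? m) (allVecs (N m) (N m)) ≡⟨ count-allVecs (m + m) (N m) _ ⟩
    sum {N m} (λ x → count (λ t → does (inΓ? m (x ∷ t)) ∧ (m ≤ᵇ toℕ x)) tails)
      ≡⟨ sum-cong-≗ (λ x → trans (count-∧-const (λ t → does (inΓ? m (x ∷ t))) (m ≤ᵇ toℕ x) tails)
                                 (cong (bit (m ≤ᵇ toℕ x) *_) (fibre-constant x))) ⟩
    sum {N m} (λ x → bit (m ≤ᵇ toℕ x) * fibre Fin.zero)
      ≡⟨ *-distribʳ-sum (fibre Fin.zero) (λ x → bit (m ≤ᵇ toℕ {N m} x)) ⟨
    sum (λ x → bit (m ≤ᵇ toℕ {N m} x)) * fibre Fin.zero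
      ≡⟨ cong (_* fibre Fin.zero) (begin
        sum (λ x → bit (m ≤ᵇ toℕ {N m} x))     ≡⟨ count-tabulate (m ≤ᵇ_) (toℕ {N m}) ⟨
        count (m ≤ᵇ_) (tabulate {n = N m} toℕ) ≡⟨ cong (count (m ≤ᵇ_)) (tabulate-+toℕ {n = N m} 0) ⟩
        count (m ≤ᵇ_) (range 0 (N m))          ≡⟨ count-≤ᵇ-range-N m ⟩
        suc m                                  ∎) ⟩
    suc m * fibre Fin.zero                      ∎

  counting : (2 * m + 1) * card (inM? m) ≡ (m + 1) * card (inΓ? m)
  counting rewrite card-M | card-Γ = arithmetic m (fibre Fin.zero)
    where
    arithmetic : ∀ m g → (2 * m + 1) * (suc m * g) ≡ (m + 1) * (suc (m + m) * g)
    arithmetic = solve-∀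

-- The involutions c_k

-- c₀ m a is the paper's c_{m+a+1}, read on {0, …, 2m}.
c₀ : (m a p : ℕ) → ℕ
c₀ m a p = cℕ m (suc (m + a)) (suc p) ∸ 1

-- Swaps m a p q: c₀ m a exchanges p and q, one constructor for each case of the paper's
-- definition of c_k.
data Swaps (m a : ℕ) : ℕ → ℕ → Set where
  up    : ∀ {p} → p < a →         Swaps m a p (m + p)
  up₁   : ∀ {p} → a ≤ p → p < m → Swaps m a p (m + suc p)
  down  : ∀ {q} → q < a →         Swaps m a (m + q) q
  fix   :                         Swaps m a (m + a) (m + a)
  down₁ : ∀ {r} → a ≤ r → r < m → Swaps m a (m + suc r) r

Swaps-sym : ∀ {m a p q} → Swaps m a p q → Swaps m a q p
Swaps-sym (up p<a)        = down p<a
Swaps-sym (up₁ a≤p p<m)   = down₁ a≤p p<m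
Swaps-sym (down q<a)      = up q<a
Swaps-sym fix             = fix
Swaps-sym (down₁ a≤r r<m) = up₁ a≤r r<m

suc[m+n]∸m≡suc[n] : ∀ m n → suc (m + n) ∸ m ≡ suc n
suc[m+n]∸m≡suc[n] m n = trans (cong (_∸ m) (sym (+-suc m n))) (m+n∸m≡n m (suc n))

Swaps⇒c₀≡ : ∀ {m a p q} → a ≤ m → Swaps m a p q → c₀ m a p ≡ q
Swaps⇒c₀≡ {m} {a} a≤m (up {p} p<a) with suc p <? suc (m + a) ∸ m
... | yes _ = +-comm p m
... | no ¬h = contradiction (subst (suc p <_) (sym (suc[m+n]∸m≡suc[n] m a)) (s≤s p<a)) ¬h
Swaps⇒c₀≡ {m} {a} a≤m (up₁ {p} a≤p p<m) with suc p <? suc (m + a) ∸ m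
... | yes h = contradiction (subst (suc p <_) (suc[m+n]∸m≡suc[n] m a) h) (≤⇒≯ (s≤s a≤p))
... | no _ with suc p ≤? m
...   | yes _ = trans (+-comm (p + m) 1) (trans (cong suc (+-comm p m)) (sym (+-suc m p)))
...   | no ¬h = contradiction p<m ¬h
Swaps⇒c₀≡ {m} {a} a≤m (down {q} q<a) with suc (m + q) <? suc (m + a) ∸ m
... | yes h = contradiction (subst (suc (m + q) <_) (suc[m+n]∸m≡suc[n] m a) h)
                            (≤⇒≯ (s≤s (≤-trans a≤m (m≤m+n m q))))
... | no _ with suc (m + q) ≤? m
...   | yes h = contradiction h (≤⇒≯ (m≤m+n m q))
...   | no _ with suc (m + q) <? suc (m + a)
...     | yes _ = cong (_∸ 1) (suc[m+n]∸m≡suc[n] m q)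
...     | no ¬h = contradiction (s≤s (+-monoʳ-< m q<a)) ¬h
Swaps⇒c₀≡ {m} {a} a≤m fix with suc (m + a) <? suc (m + a) ∸ m
... | yes h = contradiction (subst (suc (m + a) <_) (suc[m+n]∸m≡suc[n] m a) h)
                            (≤⇒≯ (s≤s (≤-trans a≤m (m≤m+n m a))))
... | no _ with suc (m + a) ≤? m
...   | yes h = contradiction h (≤⇒≯ (m≤m+n m a))
...   | no _ with suc (m + a) <? suc (m + a)
...     | yes h = contradiction h (<-irrefl refl)
...     | no _ with suc (m + a) ≟ suc (m + a)
...       | yes _ = refl
...       | no ¬h = contradiction refl ¬h
Swaps⇒c₀≡ {m} {a} a≤m (down₁ {r} a≤r r<m) with suc (m + suc r) <? suc (m + a) ∸ m
... | yes h = contradiction (subst (suc (m + suc r) <_) (suc[m+n]∸m≡suc[n] m a) h)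
                            (≤⇒≯ (s≤s (≤-trans a≤m (m≤m+n m (suc r)))))
... | no _ with suc (m + suc r) ≤? m
...   | yes h = contradiction h (≤⇒≯ (m≤m+n m (suc r)))
...   | no _ with suc (m + suc r) <? suc (m + a)
...     | yes h = contradiction (+-cancelˡ-< m (suc r) a (≤-pred h)) (≤⇒≯ (m≤n⇒m≤1+n a≤r))
...     | no _ with suc (m + suc r) ≟ suc (m + a)
...       | yes h = contradiction (+-cancelˡ-≡ m _ _ (suc-injective h)) (≢-sym (<⇒≢ (s≤s a≤r)))
...       | no _  = cong (λ t → t ∸ 1 ∸ 1) (suc[m+n]∸m≡suc[n] m (suc r))

Swaps-total : ∀ {m a p} → a ≤ m → p < N m → ∃ (Swaps m a p)
Swaps-total {m} {a} {p} a≤m p<N with p <? a | p <? m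
... | yes p<a | _       = _ , up p<a
... | no p≮a  | yes p<m = _ , up₁ (≮⇒≥ p≮a) p<m
... | no _    | no p≮m  with m≤n⇒∃[o]m+o≡n (≮⇒≥ p≮m)
...   | q , refl with <-cmp q a
...     | tri< q<a _ _  = _ , down q<a
...     | tri≈ _ refl _ = _ , fix
Swaps-total {m} {a} a≤m p<N | no _ | no _ | suc r , refl | tri> _ _ a<q =
  _ , down₁ (≤-pred a<q) (+-cancelˡ-< m r m (subst (_≤ m + m) (+-suc m r) (≤-pred p<N)))

Swaps-c₀ : ∀ {m a p} → a ≤ m → p < N m → Swaps m a p (c₀ m a p)
Swaps-c₀ a≤m p<N with Swaps-total a≤m p<N
... | _ , s = subst (Swaps _ _ _) (sym (Swaps⇒c₀≡ a≤m s)) s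

c₀-involutive : ∀ {m a p} → a ≤ m → p < N m → c₀ m a (c₀ m a p) ≡ p
c₀-involutive a≤m p<N = Swaps⇒c₀≡ a≤m (Swaps-sym (Swaps-c₀ a≤m p<N))

Swaps-< : ∀ {m a p q} → a ≤ m → Swaps m a p q → q < N m
Swaps-< {m} a≤m (up p<a)      = s≤s (+-monoʳ-≤ m (<⇒≤ (<-≤-trans p<a a≤m)))
Swaps-< {m} a≤m (up₁ _ p<m)   = s≤s (+-monoʳ-≤ m p<m)
Swaps-< {m} a≤m (down q<a)    = s≤s (≤-trans (<⇒≤ (<-≤-trans q<a a≤m)) (m≤m+n m m))
Swaps-< {m} a≤m fix           = s≤s (+-monoʳ-≤ m a≤m)
Swaps-< {m} a≤m (down₁ _ r<m) = s≤s (≤-trans (<⇒≤ r<m) (m≤m+n m m))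

Swaps-fixed : ∀ {m a p q} → 1 ≤ m → Swaps m a p q → p ≡ q → p ≡ m + a
Swaps-fixed {suc m} _ (up {p} _)      p≡q = contradiction p≡q (m≢1+n+m p)
Swaps-fixed {m}     _ (up₁ {p} _ _)   p≡q = contradiction (trans p≡q (+-suc m p)) (m≢1+n+m p)
Swaps-fixed {suc m} _ (down {q} _)    p≡q = contradiction (sym p≡q) (m≢1+n+m q)
Swaps-fixed         _ fix             _   = refl
Swaps-fixed {m}     _ (down₁ {r} _ _) p≡q = contradiction (trans (sym p≡q) (+-suc m r)) (m≢1+n+m r)

Swaps-upper : ∀ {m a p q} → a ≤ m → Swaps m a p q → m ≤ p → m ≤ q → p ≡ m + a
Swaps-upper a≤m (up p<a)      m≤p _   = contradiction (<-≤-trans p<a a≤m) (≤⇒≯ m≤p)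
Swaps-upper _   (up₁ _ p<m)   m≤p _   = contradiction p<m (≤⇒≯ m≤p)
Swaps-upper a≤m (down q<a)    _   m≤q = contradiction (<-≤-trans q<a a≤m) (≤⇒≯ m≤q)
Swaps-upper _   fix           _   _   = refl
Swaps-upper _   (down₁ _ r<m) _   m≤r = contradiction r<m (≤⇒≯ m≤r)

-- c₀ m a maps the blocks [0,a), [a,m), [m,m+a), {m+a}, (m+a,2m] increasingly onto R₁, …, R₅.
module Blocks (a b : ℕ) where

  m : ℕ
  m = a + b

  R₁ R₂ R₃ R₄ R₅ : List ℕ
  R₁ = range m a
  R₂ = range (suc (m + a)) b
  R₃ = range 0 a
  R₄ = range (m + a) 1
  R₅ = range a b

  c₀-blocks : map (c₀ m a) (range 0 (N m)) ≡ R₁ ++ R₂ ++ R₃ ++ R₄ ++ R₅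
  c₀-blocks = begin
    map f (range 0 (N m))
      ≡⟨ cong (map f ∘ range 0) (N≡ a b) ⟩
    map f (range 0 (a + (b + (a + suc b))))
      ≡⟨ cong (map f) (trans (range-++ 0 a _) (cong (range 0 a ++_)
                      (trans (range-++ a b _) (cong (range a b ++_) (range-++ m a (suc b)))))) ⟩
    map f (range 0 a ++ range a b ++ range m a ++ range (m + a) (suc b))
      ≡⟨ trans (List.map-++ f (range 0 a) _) (cong (map f (range 0 a) ++_)
               (trans (List.map-++ f (range a b) _) (cong (map f (range a b) ++_) (List.map-++ f (range m a) _)))) ⟩
    map f (range 0 a) ++ map f (range a b) ++ map f (range m a) ++ map f (range (m + a) (suc b))
      ≡⟨ cong₂ _++_ B₁ (cong₂ _++_ B₂ (cong₂ _++_ B₃ (cong₂ _∷_ (Swaps⇒c₀≡ a≤m fix) B₅))) ⟩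
    R₁ ++ R₂ ++ R₃ ++ R₄ ++ R₅ ∎
    where
    f : ℕ → ℕ
    f = c₀ m a
    a≤m : a ≤ m
    a≤m = m≤m+n a b
    N≡ : ∀ x y → suc ((x + y) + (x + y)) ≡ x + (y + (x + suc y))
    N≡ = solve-∀
    B₁ : map f (range 0 a) ≡ R₁
    B₁ = map-range f 0 m a λ j j<a → Swaps⇒c₀≡ a≤m (up j<a)
    B₂ : map f (range a b) ≡ R₂
    B₂ = map-range f a (suc (m + a)) b λ j j<b → trans (Swaps⇒c₀≡ a≤m (up₁ (m≤m+n a j) (+-monoʳ-< a j<b)))
                                                       (trans (+-suc m (a + j)) (cong suc (sym (+-assoc m a j))))
    B₃ : map f (range m a) ≡ R₃
    B₃ = map-range f m 0 a λ j j<a → Swaps⇒c₀≡ a≤m (down j<a)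
    B₅ : map f (range (suc (m + a)) b) ≡ R₅
    B₅ = map-range f (suc (m + a)) a b λ j j<b →
           trans (cong f (trans (cong suc (+-assoc m a j)) (sym (+-suc m (a + j)))))
                 (Swaps⇒c₀≡ a≤m (down₁ (m≤m+n a j) (+-monoʳ-< a j<b)))

  inv-blocks : inv id (R₁ ++ R₂ ++ R₃ ++ R₄ ++ R₅) ≡ m * m + (b + b)
  inv-blocks
    rewrite inv-++ R₁ (R₂ ++ R₃ ++ R₄ ++ R₅) | inv-++ R₂ (R₃ ++ R₄ ++ R₅)
          | inv-++ R₃ (R₄ ++ R₅) | inv-++ R₄ R₅
          | cross-++ R₁ R₂ (R₃ ++ R₄ ++ R₅) | cross-++ R₁ R₃ (R₄ ++ R₅) | cross-++ R₁ R₄ R₅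
          | cross-++ R₂ R₃ (R₄ ++ R₅) | cross-++ R₂ R₄ R₅ | cross-++ R₃ R₄ R₅
          | inv-range m a | inv-range (suc (m + a)) b | inv-range 0 a | inv-range (m + a) 1 | inv-range a b
          | cross-range-below m a (suc (m + a)) b (n≤1+n (m + a))
          | cross-range-above m a 0 a (m≤m+n a b)
          | cross-range-below m a (m + a) 1 ≤-refl
          | cross-range-above m a a b ≤-refl
          | cross-range-above (suc (m + a)) b 0 a (≤-trans (m≤n+m a m) (n≤1+n (m + a)))
          | cross-range-above (suc (m + a)) b (m + a) 1 (≤-reflexive (+-comm (m + a) 1))
          | cross-range-above (suc (m + a)) b a b (≤-trans (m≤m+n m a) (n≤1+n (m + a)))
          | cross-range-below 0 a (m + a) 1 (m≤n+m a m)
          | cross-range-below 0 a a b ≤-refl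
          | cross-range-above (m + a) 1 a b (m≤m+n m a)
          = arithmetic a b
    where
    arithmetic : ∀ x y → x * x + (0 + x * y) + (y * x + (y * 1 + y * y) + (0 + 0 + (1 * y + 0)))
                         ≡ (x + y) * (x + y) + (y + y)
    arithmetic = solve-∀

  parity-inv-c₀ : parity (inv id (map (c₀ m a) (range 0 (N m)))) ≡ parity m
  parity-inv-c₀ = begin
    parity (inv id (map (c₀ m a) (range 0 (N m)))) ≡⟨ cong (parity ∘ inv id) c₀-blocks ⟩
    parity (inv id (R₁ ++ R₂ ++ R₃ ++ R₄ ++ R₅))    ≡⟨ cong parity inv-blocks ⟩
    parity (m * m + (b + b))                       ≡⟨ ℙ.+-homo-+ (m * m) (b + b) ⟩
    parity (m * m) ℙ.+ parity (b + b)              ≡⟨ cong₂ ℙ._+_ (trans (ℙ.*-homo-* m m) (ℙ.*-idem (parity m)))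
                                                                  (trans (ℙ.+-homo-+ b b) (ℙ.p+p≡0ℙ (parity b))) ⟩
    parity m ℙ.+ 0ℙ                                ≡⟨ ℙ.+-identityʳ (parity m) ⟩
    parity m                                       ∎

toℕ-toFin : ∀ n {y} → y < suc n → toℕ (toFin n y) ≡ y
toℕ-toFin n {y} y<n with y <? suc n
... | yes y<n′ = Fin.toℕ-fromℕ< y<n′
... | no  y≮n  = contradiction y<n y≮n

module _ {m a : ℕ} (a≤m : a ≤ m) where

  cₖ : Vec' (N m)
  cₖ = c m (suc (m + a))

  toℕ-cₖ : ∀ x → toℕ (lookup cₖ x) ≡ c₀ m a (toℕ x)
  toℕ-cₖ x = trans (cong toℕ (Vec.lookup∘tabulate (λ p → toFin (m + m) (c₀ m a (toℕ p))) x))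
                   (toℕ-toFin (m + m) (Swaps-< a≤m (Swaps-c₀ a≤m (Fin.toℕ<n x))))

  cₖ-injective : IsPerm cₖ
  cₖ-injective i j e = Fin.toℕ-injective (begin
    toℕ i                   ≡⟨ c₀-involutive a≤m (Fin.toℕ<n i) ⟨
    c₀ m a (c₀ m a (toℕ i)) ≡⟨ cong (c₀ m a) (trans (sym (toℕ-cₖ i)) (trans (cong toℕ e) (toℕ-cₖ j))) ⟩
    c₀ m a (c₀ m a (toℕ j)) ≡⟨ c₀-involutive a≤m (Fin.toℕ<n j) ⟩
    toℕ j                   ∎)

  parity-inversions-cₖ : parity (inversions cₖ) ≡ parity m
  parity-inversions-cₖ with m≤n⇒∃[o]m+o≡n a≤m
  ... | b , a+b≡m = trans (cong parity (inversions≡inv-map-range cₖ (c₀ m a) toℕ-cₖ))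
    (subst (λ m → parity (inv id (map (c₀ m a) (range 0 (N m)))) ≡ parity m) a+b≡m
           (Blocks.parity-inv-c₀ a b))

  cₖ∈Γ : InΓ m cₖ
  cₖ∈Γ = cₖ-injective , λ m-even → from (%2≡0⇔parity≡0ℙ (inversions cₖ))
           (trans parity-inversions-cₖ (to (%2≡0⇔parity≡0ℙ m) m-even))
    where open Equivalence

  toℕ-·cₖ : (π : Vec' (N m)) (i : Fin (N m)) → toℕ (lookup (π · cₖ) i) ≡ c₀ m a (toℕ (lookup π i))
  toℕ-·cₖ π i = trans (cong toℕ (lookup-· π cₖ i)) (toℕ-cₖ (lookup π i))

-- The matching

index-bounds : ∀ {m a} → a ≤ m → m + 1 ≤ suc (m + a) × suc (m + a) ≤ 2 * m + 1
index-bounds {m} {a} a≤m = subst (_≤ suc (m + a)) (+-comm 1 m) (s≤s (m≤m+n m a))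
                         , subst (suc (m + a) ≤_) (sym (2m+1≡1+m+m m)) (s≤s (+-monoʳ-≤ m a≤m))
  where
  2m+1≡1+m+m : ∀ m → 2 * m + 1 ≡ suc (m + m)
  2m+1≡1+m+m = solve-∀

index-decompose : ∀ {m k} → m + 1 ≤ k → k ≤ 2 * m + 1 → ∃ λ a → a ≤ m × k ≡ suc (m + a)
index-decompose {m} m+1≤k k≤2m+1 with m≤n⇒∃[o]m+o≡n m+1≤k
... | a , refl = a , +-cancelˡ-≤ (m + 1) a m (subst (m + 1 + a ≤_) (2m+1≡m+1+m m) k≤2m+1)
                   , trans (+-assoc m 1 a) (+-suc m a)
  where
  2m+1≡m+1+m : ∀ m → 2 * m + 1 ≡ m + 1 + m
  2m+1≡m+1+m = solve-∀

first-entry : ∀ {m} (π : Vec' (N m)) → m ≤ toℕ (lookup π Fin.zero) →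
              ∃ λ a → a ≤ m × toℕ (lookup π Fin.zero) ≡ m + a
first-entry {m} π m≤π0 with m≤n⇒∃[o]m+o≡n m≤π0
... | a , m+a≡π0 =
  a , +-cancelˡ-≤ m a m (≤-pred (subst (_< N m) (sym m+a≡π0) (Fin.toℕ<n (lookup π Fin.zero)))) , sym m+a≡π0

module Partner {m a : ℕ} (a≤m : a ≤ m) (π : Vec' (N m)) (π0≡m+a : toℕ (lookup π Fin.zero) ≡ m + a) where

  σ : Vec' (N m)
  σ = π · cₖ a≤m

  σ∈M : InM m π → InM m σ
  σ∈M (π∈Γ , _) = Equivalence.from (InΓ-·ʳ m π (cₖ a≤m) (cₖ∈Γ a≤m)) π∈Γ
                , subst (m ≤_) (sym σ0≡m+a) (m≤m+n m a)
    where
    σ0≡m+a : toℕ (lookup σ Fin.zero) ≡ m + a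
    σ0≡m+a = trans (toℕ-·cₖ a≤m π Fin.zero) (trans (cong (c₀ m a) π0≡m+a) (Swaps⇒c₀≡ a≤m fix))

  π≢σ : 1 ≤ m → IsPerm π → π ≢ σ
  π≢σ 1≤m π-inj π≡σ = 1+n≢0 (trans (sym (Fin.toℕ-fromℕ< 1<N)) (cong toℕ (π-inj i Fin.zero πi≡π0)))
    where
    1<N : 1 < N m
    1<N = s≤s (≤-trans 1≤m (m≤m+n m m))
    i : Fin (N m)
    i = Fin.fromℕ< 1<N
    πi-fixed : toℕ (lookup π i) ≡ c₀ m a (toℕ (lookup π i))
    πi-fixed = trans (cong (λ v → toℕ (lookup v i)) π≡σ) (toℕ-·cₖ a≤m π i)
    πi≡π0 : lookup π i ≡ lookup π Fin.zero
    πi≡π0 = Fin.toℕ-injective (trans (Swaps-fixed 1≤m (Swaps-c₀ a≤m (Fin.toℕ<n _)) πi-fixed) (sym π0≡m+a))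

  σ-unique : ∀ τ → InM m τ → Adj m π τ → τ ≡ σ
  σ-unique τ (_ , m≤τ0) (_ , k , m+1≤k , k≤2m+1 , τ≡π·c) with index-decompose m+1≤k k≤2m+1
  ... | a′ , a′≤m , refl = trans τ≡π·c (cong (λ b → π · c m (suc (m + b))) (sym a≡a′))
    where
    m+a<N : m + a < N m
    m+a<N = subst (_< N m) π0≡m+a (Fin.toℕ<n (lookup π Fin.zero))
    τ0≡ : toℕ (lookup τ Fin.zero) ≡ c₀ m a′ (m + a)
    τ0≡ = trans (cong (λ v → toℕ (lookup v Fin.zero)) τ≡π·c)
                (trans (toℕ-·cₖ a′≤m π Fin.zero) (cong (c₀ m a′) π0≡m+a))
    a≡a′ : a ≡ a′
    a≡a′ = +-cancelˡ-≡ m a a′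
             (Swaps-upper a′≤m (Swaps-c₀ a′≤m m+a<N) (m≤m+n m a) (subst (m ≤_) τ0≡ m≤τ0))

theorem4p1 : (m : ℕ) → 1 ≤ m →
    ((2 * m + 1) * card (inM? m) ≡ (m + 1) * card (inΓ? m))
    × ((π : Vec' (N m)) → InM m π →
        Σ (Vec' (N m)) (λ σ → InM m σ × Adj m π σ
          × ((τ : Vec' (N m)) → InM m τ → Adj m π τ → τ ≡ σ)))
theorem4p1 m 1≤m = Counting.counting m , matching
  where
  matching : (π : Vec' (N m)) → InM m π →
             Σ (Vec' (N m)) (λ σ → InM m σ × Adj m π σ
               × ((τ : Vec' (N m)) → InM m τ → Adj m π τ → τ ≡ σ))
  matching π π∈M@((π-inj , _) , m≤π0) with first-entry π m≤π0
  ... | a , a≤m , π0≡m+a =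
    σ , σ∈M π∈M , (π≢σ 1≤m π-inj , suc (m + a) , proj₁ (index-bounds a≤m) , proj₂ (index-bounds a≤m) , refl)
      , σ-unique
    where open Partner a≤m π π0≡m+a
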